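{- Let $k\geq 1$ and let $D$ be a $k$-minimal digraph. Let $\varphi$ be an acyclic and complete coloring of $D$ with exactly $k$ colors, with chromatic classes $V_1,\dots,V_k$, where $|V_i|=q_i$ and $V_i=\{u_{i,1},\dots,u_{i,q_i}\}$. For each $i\in[k]$ let $m_i\geq 2$ and let $X_i=\{H_{u_{i,1}},\dots,H_{u_{i,q_i}}\}$ be a relabel factorization of $K_{m_i}$ into $q_i$ factors, where all the digraphs $H_{u_{i,j}}$ ($i\in[k]$, $j\in[q_i]$) are pairwise vertex-disjoint. Let $X=\bigcup_{i=1}^k X_i=\{H_u : u\in V(D)\}$ and $t=\sum_{i=1}^k m_i$. Then the Zykov sum $D[X]$ is $t$-minimal.
   Context: All digraphs are finite and simple (no loops, no parallel arcs; two opposite arcs forming a 2-cycle are allowed). $[n]=\{1,\dots,n\}$. $K_m$ denotes the complete symmetric digraph on $m$ vertices (every ordered pair of distinct vertices is an arc). A vertex coloring with $k$ colors is a surjection $V(D)\to[k]$; its chromatic classes are the preimages of the colors. A coloring is acyclic if each chromatic class induces a subdigraph with no directed cycle. A coloring is complete if for every ordered pair $(i,j)$ of distinct colors there is at least one arc $uv$ with $u$ colored $i$ and $v$ colored $j$. The diachromatic number $\mathrm{dac}(D)$ is the largest $k$ for which $D$ has an acyclic and complete coloring with $k$ colors. $D$ is $k$-minimal if $\mathrm{dac}(D)=k$ and $\mathrm{dac}(D-f)<k$ for every arc $f$ of $D$ (it is known that a digraph with $\mathrm{dac}(D)=k$ is $k$-minimal iff it has exactly $k(k-1)$ arcs). A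 relabel factorization of $K_m$ into $q$ factors is a family of $q$ pairwise vertex-disjoint digraphs $H_1,\dots,H_q$, where $H_j$ has vertex set $\{v^1_j,\dots,v^m_j\}$, such that for every ordered pair $(a,b)$ of distinct elements of $[m]$ there is exactly one $j\in[q]$ with $v^a_jv^b_j\in A(H_j)$, and every arc of every $H_j$ is of this form (equivalently, identifying each $v^l_j$ with vertex $l$ of $K_m$, the $H_j$ are spanning subdigraphs of $K_m$ whose arc sets partition $A(K_m)$). Zykov sum: given a digraph $D$ and a family $X=\{H_u: u\in V(D)\}$ of nonempty pairwise vertex-disjoint digraphs, $D[X]$ has vertex set $\bigcup_u V(H_u)$ and arc set $\bigcup_u A(H_u)\cup\{ab: a\in V(H_u), b\in V(H_v), uv\in A(D)\}$. -}

module Defs where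

open import Data.Nat using (ℕ; zero; suc; _≤_; _<_)
open import Data.Fin using (Fin; zero; suc; inject₁; fromℕ)
open import Data.Bool using (Bool; T)
open import Data.Product using (Σ; ∃; ∃₂; _×_; _,_)
open import Data.Sum using (_⊎_)
open import Data.List using (tabulate)
open import Data.Nat.ListAction using (sum)
open import Relation.Nullary using (¬_)
open import Relation.Binary.PropositionalEquality using (_≡_; _≢_; refl)
open import Function.Definitions using (Injective)

module _ {V : Set} (A : V → V → Set) where

  -- A directed cycle with all its vertices satisfying P: pairwise distinct
  -- vertices c 0, ..., c (l+1)  (length l+2 ≥ 2), arcs c i → c (i+1) and
  -- c (l+1) → c 0.
  HasCycleWithin : (V → Set) → Set
  HasCycleWithin P =
    Σ ℕ λ l → Σ (Fin (suc (suc l)) → V) λ c →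
      Injective _≡_ _≡_ c
      × (∀ (i : Fin (suc l)) → A (c (inject₁ i)) (c (suc i)))
      × A (c (fromℕ (suc l))) (c zero)
      × (∀ i → P (c i))

  IsSurjectiveColoring : (k : ℕ) → (V → Fin k) → Set
  IsSurjectiveColoring k φ = ∀ (j : Fin k) → ∃ λ v → φ v ≡ j

  IsAcyclicColoring : (k : ℕ) → (V → Fin k) → Set
  IsAcyclicColoring k φ = ∀ (i : Fin k) → ¬ HasCycleWithin (λ v → φ v ≡ i)

  IsCompleteColoring : (k : ℕ) → (V → Fin k) → Set
  IsCompleteColoring k φ =
    ∀ (i j : Fin k) → i ≢ j → ∃₂ λ u v → A u v × φ u ≡ i × φ v ≡ j

  IsACColoring : (k : ℕ) → (V → Fin k) → Set
  IsACColoring k φ =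
    IsSurjectiveColoring k φ × IsAcyclicColoring k φ × IsCompleteColoring k φ

  HasACColoring : ℕ → Set
  HasACColoring k = Σ (V → Fin k) (IsACColoring k)

  IsDac : ℕ → Set
  IsDac k = HasACColoring k × (∀ k′ → HasACColoring k′ → k′ ≤ k)

DeleteArc : {V : Set} → (V → V → Set) → V → V → (V → V → Set)
DeleteArc A a b u v = A u v × ¬ (u ≡ a × v ≡ b)

IsMinimal : {V : Set} → (V → V → Set) → ℕ → Set
IsMinimal A k =
  IsDac A k × (∀ a b → A a b → ∀ k′ → IsDac (DeleteArc A a b) k′ → k′ < k)

BArc : {n : ℕ} → (Fin n → Fin n → Bool) → Fin n → Fin n → Set
BArc adj u v = T (adj u v)

Loopless : {n : ℕ} → (Fin n → Fin n → Bool) → Set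
Loopless adj = ∀ v → adj v v ≡ false
  where open import Data.Bool using (false)

-- Relabel factorizations and the Zykov sum.
-- φ : coloring of D, m i : order of K_{m i}, H u : spanning subdigraph of
-- K_{m (φ u)} (vertex x of H u stands for v^x_u).

module _ {n k : ℕ} (φ : Fin n → Fin k) (m : Fin k → ℕ)
         (H : (u : Fin n) → Fin (m (φ u)) → Fin (m (φ u)) → Bool) where

  castF : ∀ {i} (u : Fin n) → φ u ≡ i → Fin (m i) → Fin (m (φ u))
  castF u refl x = x

  InFactor : (i : Fin k) → Fin (m i) → Fin (m i) → Fin n → Set
  InFactor i a b u = Σ (φ u ≡ i) λ e → T (H u (castF u e a) (castF u e b))

  -- {H u : φ u = i} is a relabel factorization of K_{m i}: each ordered pair
  -- (a,b), a ≠ b, is covered by exactly one factor (the factors being loopless,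
  -- every arc is of this form).
  IsRelabelFactorization : Fin k → Set
  IsRelabelFactorization i =
    ∀ (a b : Fin (m i)) → a ≢ b →
      (∃ λ u → InFactor i a b u)
      × (∀ u u′ → InFactor i a b u → InFactor i a b u′ → u ≡ u′)

  ZVertex : Set
  ZVertex = Σ (Fin n) λ u → Fin (m (φ u))

  -- arcs of the Zykov sum D[X] (the H u are made disjoint by tagging with u)
  data ZykovArc (adj : Fin n → Fin n → Bool) : ZVertex → ZVertex → Set where
    inner : ∀ u x y → T (H u x y) → ZykovArc adj (u , x) (u , y)
    outer : ∀ u v x y → T (adj u v) → ZykovArc adj (u , x) (v , y)

sumFin : {k : ℕ} → (Fin k → ℕ) → ℕ
sumFin m = sum (tabulate m)

{-# OPTIONS --safe #-}
-- Let label be the projection v^x_u ↦ (φ u, x) of D[X] onto the t vertices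
-- of the disjoint union of the K_{m_i}.  Minimality of D forces every arc of D to
-- join two different classes and each ordered pair of classes to be joined by
-- exactly one arc; together with the relabel factorizations this makes label a
-- bijection between the arcs of D[X] and those of K_t.  Hence a complete
-- coloring of D[X] with k′ colors needs k′(k′−1) ≤ t(t−1), and after deleting
-- an arc k′(k′−1) < t(t−1); while label itself, read as a coloring with t
-- colors, is complete (it hits every arc of K_t) and acyclic (an arc inside a
-- class of label lies over an arc of D inside a class of φ).
module Submission where

open import Defs
open import Data.Nat using (ℕ; zero; suc; pred; _*_; _≤_; _<_; z≤n; s≤s)
open import Data.Nat.Properties
  using (≤-trans; ≤-pred; ≤-<-trans; ≤∧≢⇒<; <⇒≱; ≰⇒>; *-mono-≤; *-mono-<; pred-mono-≤; n<1+n; m≤m+n)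
open import Data.Fin using (Fin; zero; suc; _≟_; combine; remQuot; punchOut; _↑ˡ_; _↑ʳ_; splitAt; join)
open import Data.Fin.Properties
  using (combine-injective; combine-remQuot; punchIn-injective; punchInᵢ≢i; punchOut-injective;
         injective⇒≤; splitAt-↑ˡ; splitAt-↑ʳ; join-splitAt)
open import Data.Bool using (Bool; T; false)
open import Data.Product using (Σ; ∃; ∃₂; _×_; _,_; proj₁; proj₂; uncurry)
open import Data.Sum using (inj₁; inj₂)
open import Data.Empty using (⊥-elim)
open import Function using (id; _∘_)
open import Relation.Nullary using (¬_; yes; no; contradiction)
open import Relation.Nullary.Decidable using (_×-dec_; ¬¬-excluded-middle)
open import Relation.Binary.PropositionalEquality using (_≡_; _≢_; refl; sym; trans; cong; subst)

record ArcInjection {V : Set} (A : V → V → Set) (N : ℕ) : Set where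
  field
    index           : ∀ {u v} → A u v → Fin N
    index-injective : ∀ {u v u′ v′} (uv : A u v) (u′v′ : A u′ v′) →
                      index uv ≡ index u′v′ → u ≡ u′ × v ≡ v′

open ArcInjection

≢-arcInjection : ∀ {t} → ArcInjection (_≢_ {A = Fin t}) (t * pred t)
≢-arcInjection = record { index = pairIndex ; index-injective = pairIndex-injective }
  where
  pairIndex : ∀ {t} {p q : Fin t} → p ≢ q → Fin (t * pred t)
  pairIndex {suc _} {p} p≢q = combine p (punchOut p≢q)

  pairIndex-injective : ∀ {t} {p q p′ q′ : Fin t} (p≢q : p ≢ q) (p′≢q′ : p′ ≢ q′) →
                        pairIndex p≢q ≡ pairIndex p′≢q′ → p ≡ p′ × q ≡ q′
  pairIndex-injective {suc _} {p} {p′ = p′} p≢q p′≢q′ eq with combine-injective p _ p′ _ eq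
  ... | refl , eq′ = refl , punchOut-injective p≢q p′≢q′ eq′

≢-arcInjection⇒≤ : ∀ {k N} → ArcInjection (_≢_ {A = Fin k}) N → k * pred k ≤ N
≢-arcInjection⇒≤ {zero}  f = z≤n
≢-arcInjection⇒≤ {suc k} f = injective⇒≤ {f = g ∘ remQuot k} g∘remQuot-injective
  where
  g : Fin (suc k) × Fin k → Fin _
  g (a , c) = index f (punchInᵢ≢i a c ∘ sym)

  g-injective : ∀ {x y} → g x ≡ g y → x ≡ y
  g-injective {a , c} {a′ , c′} eq with index-injective f _ _ eq
  ... | refl , eq′ = cong (a ,_) (punchIn-injective a c c′ eq′)

  g∘remQuot-injective : ∀ {x y} → g (remQuot k x) ≡ g (remQuot k y) → x ≡ y
  g∘remQuot-injective {x} {y} eq =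
    trans (sym (combine-remQuot k x)) (trans (cong (uncurry combine) (g-injective eq)) (combine-remQuot k y))

module _ {V : Set} where

  completeColoring-pairs≤ : ∀ {A : V → V → Set} {k N} {ψ : V → Fin k} → ArcInjection A N →
                            IsCompleteColoring A k ψ → k * pred k ≤ N
  completeColoring-pairs≤ {k = k} {N} {ψ} f complete = ≢-arcInjection⇒≤ colorPairs
    where
    colorPairs : ArcInjection (_≢_ {A = Fin k}) N
    colorPairs = record
      { index           = λ {c} {d} c≢d → index f (proj₁ (proj₂ (proj₂ (complete c d c≢d))))
      ; index-injective = λ {c} {d} {c′} {d′} c≢d c′≢d′ eq →
          let (_ , _ , uv , ψu≡c , ψv≡d)       = complete c d c≢d
              (_ , _ , u′v′ , ψu′≡c′ , ψv′≡d′) = complete c′ d′ c′≢d′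
              (u≡u′ , v≡v′)                    = index-injective f uv u′v′ eq
          in trans (sym ψu≡c) (trans (cong ψ u≡u′) ψu′≡c′)
           , trans (sym ψv≡d) (trans (cong ψ v≡v′) ψv′≡d′)
      }

  deleteArc-arcInjection : ∀ {A : V → V → Set} {N a b} (f : ArcInjection A (suc N)) → A a b →
                           ArcInjection (DeleteArc A a b) N
  deleteArc-arcInjection {A} {a = a} {b} f ab = record
    { index           = λ uv → punchOut (index-≢ uv)
    ; index-injective = λ uv u′v′ eq →
        index-injective f (proj₁ uv) (proj₁ u′v′) (punchOut-injective (index-≢ uv) (index-≢ u′v′) eq)
    }
    where
    index-≢ : ∀ {u v} (uv : DeleteArc A a b u v) → index f ab ≢ index f (proj₁ uv)
    index-≢ (uv , uv≢ab) eq = uv≢ab (index-injective f uv ab (sym eq))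

  deleteArc-pairs< : ∀ {A : V → V → Set} {k N a b} {ψ : V → Fin k} → ArcInjection A N → A a b →
                     IsCompleteColoring (DeleteArc A a b) k ψ → k * pred k < N
  deleteArc-pairs< {N = zero} f ab _ with index f ab
  ... | ()
  deleteArc-pairs< {N = suc _} {ψ = ψ} f ab complete =
    s≤s (completeColoring-pairs≤ {ψ = ψ} (deleteArc-arcInjection f ab) complete)

*-pred-mono-≤ : ∀ {m n} → m ≤ n → m * pred m ≤ n * pred n
*-pred-mono-≤ m≤n = *-mono-≤ m≤n (pred-mono-≤ m≤n)

*-pred-cancel-< : ∀ {m n} → m * pred m < n * pred n → m < n
*-pred-cancel-< lt = ≰⇒> (<⇒≱ lt ∘ *-pred-mono-≤)

*-pred-cancel-≤ : ∀ {m n} → 1 ≤ n → m * pred m ≤ n * pred n → m ≤ n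
*-pred-cancel-≤ {n = suc n} _ le =
  ≤-pred (*-pred-cancel-< (≤-<-trans le (*-mono-< (n<1+n (suc n)) (n<1+n n))))

cycle-map : ∀ {V W : Set} {A : V → V → Set} {B : W → W → Set} {P : V → Set} {Q : W → Set}
            (f : V → W) →
            (∀ {u v} → P u → P v → f u ≡ f v → u ≡ v) →
            (∀ {u v} → P u → P v → A u v → B (f u) (f v)) →
            (∀ {u} → P u → Q (f u)) →
            HasCycleWithin A P → HasCycleWithin B Q
cycle-map f f-injective f-arc f-class (l , c , c-injective , arcs , closing , inP) =
  l , f ∘ c , (λ eq → c-injective (f-injective (inP _) (inP _) eq))
    , (λ i → f-arc (inP _) (inP _) (arcs i)) , f-arc (inP _) (inP _) closing , f-class ∘ inP

deleteArc-acyclic : ∀ {V : Set} {A : V → V → Set} {k a b} {φ : V → Fin k} →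
                    IsAcyclicColoring A k φ → IsAcyclicColoring (DeleteArc A a b) k φ
deleteArc-acyclic {A = A} {a = a} {b} {φ} acyclic i =
  acyclic i ∘ cycle-map {A = DeleteArc A a b} {B = A} {P = λ v → φ v ≡ i} id (λ _ _ → id) (λ _ _ → proj₁) id

surjective-≤ : ∀ {n k} {A : Fin n → Fin n → Set} {ψ : Fin n → Fin k} →
               IsSurjectiveColoring A k ψ → k ≤ n
surjective-≤ {ψ = ψ} surjective = injective⇒≤ λ {i} {j} eq →
  trans (sym (proj₂ (surjective i))) (trans (cong ψ eq) (proj₂ (surjective j)))

-- The maximum exists only up to double negation: the predicate is not decidable.
¬¬-maximum : (P : ℕ → Set) (N : ℕ) → (∀ j → P j → j ≤ N) → ∀ {k} → P k →
             ¬ ¬ ∃ λ j → P j × (∀ j′ → P j′ → j′ ≤ j)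
¬¬-maximum P zero    bounded {k} pk noMaximum with bounded k pk
... | z≤n = noMaximum (zero , pk , bounded)
¬¬-maximum P (suc N) bounded pk noMaximum = ¬¬-excluded-middle λ where
  (yes pN) → noMaximum (suc N , pN , bounded)
  (no ¬pN) → ¬¬-maximum P N (λ j pj → ≤-pred (≤∧≢⇒< (bounded j pj) λ { refl → ¬pN pj })) pk noMaximum

module MinimalDigraph {n k : ℕ} {A : Fin n → Fin n → Set} {φ : Fin n → Fin k}
                      (minimal : IsMinimal A k) (φ-ac : IsACColoring A k φ) where

  arc-essential : ∀ {a b} → A a b → ¬ IsCompleteColoring (DeleteArc A a b) k φ
  arc-essential {a} {b} ab complete =
    ¬¬-maximum (HasACColoring (DeleteArc A a b)) n (λ _ (ψ , surjective , _) → surjective-≤ {A = DeleteArc A a b} {ψ = ψ} surjective)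
      φ-ac′ λ (j , dac) → <⇒≱ (proj₂ minimal a b ab j dac) (proj₂ dac k φ-ac′)
    where
    φ-ac′ : HasACColoring (DeleteArc A a b) k
    φ-ac′ = φ , proj₁ φ-ac , deleteArc-acyclic {A = A} {a = a} {b} {φ} (proj₁ (proj₂ φ-ac)) , complete

  deleteArc-complete : ∀ {a b} →
    (∀ {i j} → i ≢ j → φ a ≡ i → φ b ≡ j → ∃₂ λ u v → DeleteArc A a b u v × φ u ≡ i × φ v ≡ j) →
    IsCompleteColoring (DeleteArc A a b) k φ
  deleteArc-complete {a} {b} reroute i j i≢j with proj₂ (proj₂ φ-ac) i j i≢j
  ... | u , v , uv , φu≡i , φv≡j with (u ≟ a) ×-dec (v ≟ b)
  ...   | yes (refl , refl) = reroute i≢j φu≡i φv≡j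
  ...   | no uv≢ab          = u , v , (uv , uv≢ab) , φu≡i , φv≡j

  arc-colors-≢ : ∀ {u v} → A u v → φ u ≢ φ v
  arc-colors-≢ uv φu≡φv = arc-essential uv (deleteArc-complete λ i≢j φu≡i φv≡j →
    contradiction (trans (sym φu≡i) (trans φu≡φv φv≡j)) i≢j)

  arc-determined-by-colors : ∀ {u v u′ v′} → A u v → A u′ v′ →
                             φ u ≡ φ u′ → φ v ≡ φ v′ → u ≡ u′ × v ≡ v′
  arc-determined-by-colors {u} {v} {u′} {v′} uv u′v′ φu≡φu′ φv≡φv′ with (u′ ≟ u) ×-dec (v′ ≟ v)
  ... | yes (refl , refl) = refl , refl
  ... | no u′v′≢uv        = ⊥-elim (arc-essential uv (deleteArc-complete λ _ φu≡i φv≡j →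
                              u′ , v′ , (u′v′ , u′v′≢uv) , trans (sym φu≡φu′) φu≡i , trans (sym φv≡φv′) φv≡j))

joinΣ : ∀ {k} (m : Fin k → ℕ) → Σ (Fin k) (λ i → Fin (m i)) → Fin (sumFin m)
joinΣ {suc _} m (zero  , a) = a ↑ˡ sumFin (m ∘ suc)
joinΣ {suc _} m (suc i , a) = m zero ↑ʳ joinΣ (m ∘ suc) (i , a)

splitΣ : ∀ {k} (m : Fin k → ℕ) → Fin (sumFin m) → Σ (Fin k) (λ i → Fin (m i))
splitΣ {suc _} m x with splitAt (m zero) x
... | inj₁ a = zero , a
... | inj₂ y with splitΣ (m ∘ suc) y
...   | i , a = suc i , a

splitΣ-joinΣ : ∀ {k} (m : Fin k → ℕ) ia → splitΣ m (joinΣ m ia) ≡ ia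
splitΣ-joinΣ {suc _} m (zero , a) rewrite splitAt-↑ˡ (m zero) a (sumFin (m ∘ suc)) = refl
splitΣ-joinΣ {suc _} m (suc i , a)
  rewrite splitAt-↑ʳ (m zero) (sumFin (m ∘ suc)) (joinΣ (m ∘ suc) (i , a))
        | splitΣ-joinΣ (m ∘ suc) (i , a) = refl

joinΣ-splitΣ : ∀ {k} (m : Fin k → ℕ) x → joinΣ m (splitΣ m x) ≡ x
joinΣ-splitΣ {suc _} m x with splitAt (m zero) x in eq
... | inj₁ a = trans (cong (join (m zero) _) (sym eq)) (join-splitAt (m zero) _ x)
... | inj₂ y with splitΣ (m ∘ suc) y in eq′
...   | i , a = trans (cong (m zero ↑ʳ_) (trans (cong (joinΣ (m ∘ suc)) (sym eq′)) (joinΣ-splitΣ (m ∘ suc) y)))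
                  (trans (cong (join (m zero) _) (sym eq)) (join-splitAt (m zero) _ x))

joinΣ-injective : ∀ {k} (m : Fin k → ℕ) {ia jb} → joinΣ m ia ≡ joinΣ m jb → ia ≡ jb
joinΣ-injective m {ia} {jb} eq = trans (sym (splitΣ-joinΣ m ia)) (trans (cong (splitΣ m) eq) (splitΣ-joinΣ m jb))

module ZykovSum {n k : ℕ} {adj : Fin n → Fin n → Bool} {φ : Fin n → Fin k}
                (minimal : IsMinimal (BArc adj) k) (φ-ac : IsACColoring (BArc adj) k φ)
                (m : Fin k → ℕ) (H : (u : Fin n) → Fin (m (φ u)) → Fin (m (φ u)) → Bool)
                (H-loopless : ∀ u x → H u x x ≡ false)
                (relabel : ∀ i → IsRelabelFactorization φ m H i) where

  open MinimalDigraph minimal φ-ac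

  V : Set
  V = ZVertex φ m H

  Z : V → V → Set
  Z = ZykovArc φ m H adj

  t : ℕ
  t = sumFin m

  label : V → Σ (Fin k) (λ i → Fin (m i))
  label (u , x) = φ u , x

  ψ : V → Fin t
  ψ = joinΣ m ∘ label

  label-castF : ∀ {i} u (φu≡i : φ u ≡ i) a → label (u , castF φ m H u φu≡i a) ≡ (i , a)
  label-castF u refl a = refl

  vertex-≡ : ∀ {p q : V} → proj₁ p ≡ proj₁ q → label p ≡ label q → p ≡ q
  vertex-≡ refl refl = refl

  H-arc-≢ : ∀ {u a b} → T (H u a b) → a ≢ b
  H-arc-≢ {u} {a} h refl = subst T (H-loopless u a) h

  arc-label-≢ : ∀ {p q} → Z p q → label p ≢ label q
  arc-label-≢ (inner u a b h)    refl = H-arc-≢ h refl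
  arc-label-≢ (outer u v a b uv) eq   = arc-colors-≢ uv (cong proj₁ eq)

  arc-same-label⇒arc : ∀ {p q} → Z p q → label p ≡ label q → BArc adj (proj₁ p) (proj₁ q)
  arc-same-label⇒arc pq@(inner _ _ _ _) eq = contradiction eq (arc-label-≢ pq)
  arc-same-label⇒arc (outer _ _ _ _ uv) _  = uv

  inFactor : ∀ {i a b u} {x y : Fin (m (φ u))} →
             (i , a) ≡ label (u , x) → (i , b) ≡ label (u , y) → T (H u x y) → InFactor φ m H i a b u
  inFactor refl refl h = refl , h

  arc-determined-by-label : ∀ {p q p′ q′} → Z p q → Z p′ q′ →
                            label p ≡ label p′ → label q ≡ label q′ → p ≡ p′ × q ≡ q′
  arc-determined-by-label (inner u a b h) (inner u′ _ _ h′) ea eb =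
    let u≡u′ = proj₂ (relabel (φ u) a b (H-arc-≢ h)) u u′ (refl , h) (inFactor ea eb h′)
    in vertex-≡ u≡u′ ea , vertex-≡ u≡u′ eb
  arc-determined-by-label (inner _ _ _ _) (outer _ _ _ _ u′v′) ea eb =
    ⊥-elim (arc-colors-≢ u′v′ (trans (sym (cong proj₁ ea)) (cong proj₁ eb)))
  arc-determined-by-label (outer _ _ _ _ uv) (inner _ _ _ _) ea eb =
    ⊥-elim (arc-colors-≢ uv (trans (cong proj₁ ea) (sym (cong proj₁ eb))))
  arc-determined-by-label (outer _ _ _ _ uv) (outer _ _ _ _ u′v′) ea eb =
    let (u≡u′ , v≡v′) = arc-determined-by-colors uv u′v′ (cong proj₁ ea) (cong proj₁ eb)
    in vertex-≡ u≡u′ ea , vertex-≡ v≡v′ eb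

  arc-between-labels : ∀ {ia jb} → ia ≢ jb → ∃₂ λ p q → Z p q × label p ≡ ia × label q ≡ jb
  arc-between-labels {i , a} {j , b} ia≢jb with i ≟ j
  ... | no i≢j =
    let (u , v , uv , φu≡i , φv≡j) = proj₂ (proj₂ φ-ac) i j i≢j
    in (u , castF φ m H u φu≡i a) , (v , castF φ m H v φv≡j b) , outer u v _ _ uv
     , label-castF u φu≡i a , label-castF v φv≡j b
  ... | yes refl =
    let ((u , φu≡i , h) , _) = relabel i a b (ia≢jb ∘ cong (i ,_))
    in (u , castF φ m H u φu≡i a) , (u , castF φ m H u φu≡i b) , inner u _ _ h
     , label-castF u φu≡i a , label-castF u φu≡i b

  arcInjection : ArcInjection Z (t * pred t)
  arcInjection = record
    { index           = λ pq → index ≢-arcInjection (arc-label-≢ pq ∘ joinΣ-injective m)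
    ; index-injective = λ pq p′q′ eq →
        let (ψp≡ψp′ , ψq≡ψq′) = index-injective ≢-arcInjection _ _ eq
        in arc-determined-by-label pq p′q′ (joinΣ-injective m ψp≡ψp′) (joinΣ-injective m ψq≡ψq′)
    }

  ψ-≡ : ∀ {p c} → label p ≡ splitΣ m c → ψ p ≡ c
  ψ-≡ {c = c} eq = trans (cong (joinΣ m) eq) (joinΣ-splitΣ m c)

  label-≡ : ∀ {p c} → ψ p ≡ c → label p ≡ splitΣ m c
  label-≡ eq = trans (sym (splitΣ-joinΣ m _)) (cong (splitΣ m) eq)

  ψ-surjective : IsSurjectiveColoring Z t ψ
  ψ-surjective c =
    let (i , a) = splitΣ m c
        (u , φu≡i) = proj₁ φ-ac i
    in (u , castF φ m H u φu≡i a) , ψ-≡ (label-castF u φu≡i a)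

  ψ-complete : IsCompleteColoring Z t ψ
  ψ-complete c d c≢d =
    let (p , q , pq , ep , eq) = arc-between-labels (c≢d ∘ joinΣ-splitΣ-≡)
    in p , q , pq , ψ-≡ ep , ψ-≡ eq
    where
    joinΣ-splitΣ-≡ : splitΣ m c ≡ splitΣ m d → c ≡ d
    joinΣ-splitΣ-≡ eq = trans (sym (joinΣ-splitΣ m c)) (trans (cong (joinΣ m) eq) (joinΣ-splitΣ m d))

  ψ-acyclic : IsAcyclicColoring Z t ψ
  ψ-acyclic c = proj₁ (proj₂ φ-ac) (proj₁ (splitΣ m c)) ∘ cycle-map proj₁
    (λ ψp≡c ψq≡c u≡v → vertex-≡ u≡v (same-label ψp≡c ψq≡c))
    (λ ψp≡c ψq≡c pq → arc-same-label⇒arc pq (same-label ψp≡c ψq≡c))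
    (cong proj₁ ∘ label-≡)
    where
    same-label : ∀ {p q} → ψ p ≡ c → ψ q ≡ c → label p ≡ label q
    same-label ψp≡c ψq≡c = trans (label-≡ ψp≡c) (sym (label-≡ ψq≡c))

  zykov-minimal : 1 ≤ t → IsMinimal Z t
  zykov-minimal 1≤t =
    ((ψ , ψ-surjective , ψ-acyclic , ψ-complete) ,
      λ _ (ψ′ , _ , _ , complete) →
        *-pred-cancel-≤ 1≤t (completeColoring-pairs≤ {ψ = ψ′} arcInjection complete)) ,
    λ _ _ ab _ ((ψ′ , _ , _ , complete) , _) →
      *-pred-cancel-< (deleteArc-pairs< {ψ = ψ′} arcInjection ab complete)

theorem2 : (n k : ℕ) → 1 ≤ k
    → (adj : Fin n → Fin n → Bool) → Loopless adj
    → IsMinimal (BArc adj) k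
    → (φ : Fin n → Fin k) → IsACColoring (BArc adj) k φ
    → (m : Fin k → ℕ) → (∀ i → 2 ≤ m i)
    → (H : (u : Fin n) → Fin (m (φ u)) → Fin (m (φ u)) → Bool)
    → (∀ u x → H u x x ≡ false)
    → (∀ i → IsRelabelFactorization φ m H i)
    → IsMinimal (ZykovArc φ m H adj) (sumFin m)
theorem2 n (suc k) (s≤s z≤n) adj _ minimal φ φ-ac m 2≤m H H-loopless relabel =
  zykov-minimal (≤-trans (≤-trans (s≤s z≤n) (2≤m zero)) (m≤m+n (m zero) _))
  where open ZykovSum minimal φ-ac m H H-loopless relabel
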